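{- Let $M$ be a monoid and $\mathcal{R}'_M$ an equivalence relation on $\mathbf{T}(\mathcal{G}_M)$ containing $\mathcal{R}_M$. If $\equiv'$ is the clone congruence of $\mathbf{P}(M)$ generated by the pairs $(\mathrm{fr}_M(t),\mathrm{fr}_M(t'))$ for all $t\,\mathcal{R}'_M\,t'$, then $(\mathcal{G}_M,\mathcal{R}'_M)$ is a presentation of the clone $\mathbf{P}(M)/_{\equiv'}$.
   Context: Clones: a clone $C$ is a graded set with superposition maps $C(n)\times C(m)^n\to C(m)$, $x[y_1,\dots,y_n]$, and projections $\mathbf{1}_{i,n}$ satisfying $\mathbf{1}_{i,n}[y_1,\dots,y_n]=y_i$, $x[\mathbf{1}_{1,n},\dots,\mathbf{1}_{n,n}]=x$ and $x[y_1,\dots,y_n][z_1,\dots,z_m]=x[y_1[z_1,\dots,z_m],\dots,y_n[z_1,\dots,z_m]]$; clone congruences are arity-preserving equivalence relations compatible with superposition; the clone congruence generated by a set of pairs is the smallest clone congruence containing them. Let $(M,\cdot,e)$ be a monoid. $M$-pigmented letters are pairs $i^\alpha$ ($i\ge1$, $\alpha\in M$); $\mathbf{P}(M)(n)$ is the set of words of such letters with values in $[n]$. With $\alpha\odot i_1^{\alpha_1}\cdots i_\ell^{\alpha_\ell}:=i_1^{\alpha\alpha_1}\cdots i_\ell^{\alpha\alpha_\ell}$, $\mathbf{P}(M)$ is the clone with $i_1^{\alpha_1}\cdots i_\ell^{\alpha_\ell}[\mathfrak{p}_1,\dots,\mathfrak{p}_n]:=(\alpha_1\odot\mathfrak{p}_{i_1})\cdots(\alpha_\ell\odot\mathfrak{p}_{i_\ell})$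 and projections $i^e$. Terms: $\mathbf{T}(\mathcal{G})(n)$ is the set of $\mathcal{G}$-terms with variables among $x_1,\dots,x_n$ (free clone: superposition = substitution, projections $x_i$). For a variety $(\mathcal{G},\mathcal{R})$ ($\mathcal{R}$ an equivalence relation on terms), $\equiv_{\mathcal{R}}$ is the smallest clone congruence containing $\mathcal{R}$; $(\mathcal{G},\mathcal{R})$ is a presentation of $C$ if $C\cong\mathbf{T}(\mathcal{G})/_{\equiv_{\mathcal{R}}}$. $\mathcal{G}_M(0)=\{\mathsf{u}\}$, $\mathcal{G}_M(1)=\{\mathsf{p}_\alpha:\alpha\in M\}$, $\mathcal{G}_M(2)=\{\star\}$; $\mathcal{R}_M$ is the equivalence relation generated by $\star[\star[x_1,x_2],x_3]\sim\star[x_1,\star[x_2,x_3]]$, $\star[\mathsf{u},x_1]\sim x_1\sim\star[x_1,\mathsf{u}]$, $\mathsf{p}_\alpha[\star[x_1,x_2]]\sim\star[\mathsf{p}_\alpha[x_1],\mathsf{p}_\alpha[x_2]]$, $\mathsf{p}_\alpha[\mathsf{u}]\sim\mathsf{u}$, $\mathsf{p}_{\alpha_1}[\mathsf{p}_{\alpha_2}[x_1]]\sim\mathsf{p}_{\alpha_1\alpha_2}[x_1]$, $\mathsf{p}_e[x_1]\sim x_1$. The frontier map $\mathrm{fr}_M:\mathbf{T}(\mathcal{G}_M)\to\mathbf{P}(M)$ is the arity-preserving map obtained by replacing $\mathsf{u}$ by $\epsilon\in\mathbf{P}(M)(0)$, $\mathsf{p}_\alpha$ by $1^\alpha\in\mathbf{P}(M)(1)$,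 $\star$ by $1^e2^e\in\mathbf{P}(M)(2)$, and evaluating in $\mathbf{P}(M)$: $\mathrm{fr}_M(x_i)=i^e$ and $\mathrm{fr}_M(g[t_1,\dots,t_k])=\mathrm{fr}_M(g)[\mathrm{fr}_M(t_1),\dots,\mathrm{fr}_M(t_k)]$. -}

module Defs where

open import Data.Nat using (ℕ; zero; suc)
open import Data.Fin using (Fin; zero; suc)
open import Data.List using (List; []; _∷_; map; concatMap)
open import Data.Product using (_×_; _,_; Σ; ∃)
open import Relation.Binary.PropositionalEquality using (_≡_)
open import Relation.Binary.Construct.Closure.Equivalence using (EqClosure)

data CloneCong {C : ℕ → Set}
               (sup : ∀ {n m} → C n → (Fin n → C m) → C m)
               (R : ∀ n → C n → C n → Set)
               : ∀ n → C n → C n → Set where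
  base  : ∀ {n x y} → R n x y → CloneCong sup R n x y
  refl  : ∀ {n x} → CloneCong sup R n x x
  sym   : ∀ {n x y} → CloneCong sup R n x y → CloneCong sup R n y x
  trans : ∀ {n x y z} → CloneCong sup R n x y → CloneCong sup R n y z
        → CloneCong sup R n x z
  comp  : ∀ {n m x x'} {ys ys' : Fin n → C m}
        → CloneCong sup R n x x'
        → (∀ i → CloneCong sup R m (ys i) (ys' i))
        → CloneCong sup R m (sup x ys) (sup x' ys')

-- Isomorphism of quotient clones C/≈C and D/≈D, given through
-- representatives (setoid maps): a family of arity-preserving maps
-- compatible with the congruences, injective and surjective modulo the
-- congruences, and commuting with superposition and projections.

record CloneIso {C D : ℕ → Set}
                (supC : ∀ {n m} → C n → (Fin n → C m) → C m)
                (projC : ∀ {n} → Fin n → C n)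
                (_≈C_ : ∀ {n} → C n → C n → Set)
                (supD : ∀ {n m} → D n → (Fin n → D m) → D m)
                (projD : ∀ {n} → Fin n → D n)
                (_≈D_ : ∀ {n} → D n → D n → Set) : Set where
  field
    φ        : ∀ {n} → C n → D n
    φ-resp   : ∀ {n} {x y : C n} → x ≈C y → φ x ≈D φ y
    φ-inj    : ∀ {n} {x y : C n} → φ x ≈D φ y → x ≈C y
    φ-surj   : ∀ {n} (d : D n) → Σ (C n) (λ c → φ c ≈D d)
    φ-sup    : ∀ {n m} (x : C n) (ys : Fin n → C m)
             → φ (supC x ys) ≈D supD (φ x) (λ i → φ (ys i))
    φ-proj   : ∀ {n} (i : Fin n) → φ (projC i) ≈D projD i

-- The clone P(M) of M-pigmented words.  A letter i^α with i ∈ [n] is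
-- a pair (i , α) : Fin n × M.

PW : Set → ℕ → Set
PW M n = List (Fin n × M)

act : {M : Set} → (M → M → M) → M → ∀ {m} → PW M m → PW M m
act _·_ α = map (λ { (j , β) → (j , α · β) })

psup : {M : Set} → (M → M → M) → ∀ {n m} → PW M n → (Fin n → PW M m) → PW M m
psup _·_ w ps = concatMap (λ { (i , α) → act _·_ α (ps i) }) w

pproj : {M : Set} → M → ∀ {n} → Fin n → PW M n
pproj e i = (i , e) ∷ []

data Term (M : Set) (n : ℕ) : Set where
  var  : Fin n → Term M n
  u    : Term M n
  p    : M → Term M n → Term M n
  star : Term M n → Term M n → Term M n

tsub : {M : Set} → ∀ {n m} → Term M n → (Fin n → Term M m) → Term M m
tsub (var i)    σ = σ i
tsub u          σ = u
tsub (p α t)    σ = p α (tsub t σ)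
tsub (star s t) σ = star (tsub s σ) (tsub t σ)

tproj : {M : Set} → ∀ {n} → Fin n → Term M n
tproj i = var i

-- Generating pairs of R_M (each at the arity in which it is written),
-- and R_M itself as the equivalence relation they generate.

private
  x₁ : ∀ {M n} → Term M (suc n)
  x₁ = var zero
  x₂ : ∀ {M n} → Term M (suc (suc n))
  x₂ = var (suc zero)
  x₃ : ∀ {M n} → Term M (suc (suc (suc n)))
  x₃ = var (suc (suc zero))

data RMgen {M : Set} (_·_ : M → M → M) (e : M) : ∀ n → Term M n → Term M n → Set where
  assoc  : RMgen _·_ e 3 (star (star x₁ x₂) x₃) (star x₁ (star x₂ x₃))
  unitˡ  : RMgen _·_ e 1 (star u x₁) x₁
  unitʳ  : RMgen _·_ e 1 x₁ (star x₁ u)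
  p-star : ∀ α → RMgen _·_ e 2 (p α (star x₁ x₂)) (star (p α x₁) (p α x₂))
  p-u    : ∀ α → RMgen _·_ e 0 (p α u) u
  p-p    : ∀ α₁ α₂ → RMgen _·_ e 1 (p α₁ (p α₂ x₁)) (p (α₁ · α₂) x₁)
  p-e    : RMgen _·_ e 1 (p e x₁) x₁

RM : {M : Set} → (M → M → M) → M → ∀ n → Term M n → Term M n → Set
RM _·_ e n = EqClosure (RMgen _·_ e n)

fr : {M : Set} → (M → M → M) → M → ∀ {n} → Term M n → PW M n
fr _·_ e (var i)      = pproj e i
fr _·_ e u            = []
fr _·_ e (p α t)      = psup _·_ {n = 1} ((zero , α) ∷ []) (λ _ → fr _·_ e t)
fr _·_ e (star t₁ t₂) =
  psup _·_ {n = 2} ((zero , e) ∷ (suc zero , e) ∷ [])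
       (λ { zero → fr _·_ e t₁ ; (suc _) → fr _·_ e t₂ })

FrPairs : ∀ {M : Set} → (M → M → M) → M
        → (∀ n → Term M n → Term M n → Set)
        → ∀ n → PW M n → PW M n → Set
FrPairs {M} _·_ e R' n w w' =
  Σ (Term M n) λ t → Σ (Term M n) λ t' →
    R' n t t' × fr _·_ e t ≡ w × fr _·_ e t' ≡ w'

{-# OPTIONS --safe #-}
-- The frontier map fr is a clone morphism T(G_M) → P(M).  It has a section
-- on representatives, reading a word i₁^α₁ ⋯ iₗ^αₗ as the comb
-- ⋆[p_α₁ x_i₁, ⋆[…, ⋆[p_αₗ x_iₗ, u]]], and the relations of R_M (associativity
-- and unit of ⋆, the action of the p_α distributing over ⋆ and u) are exactly
-- what is needed to rewrite any term t into the comb of fr t.  So modulo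
-- R_M ⊆ R' both composites are the identity, and each map sends generating
-- pairs of one congruence into the other.
module Submission where

open import Defs
open import Data.Nat using (ℕ)
open import Data.Fin using (Fin; zero; suc)
open import Data.Product using (_,_)
open import Data.List using ([]; _∷_; _++_)
open import Data.List.Properties
  using (++-identityʳ; map-∘; map-cong; map-id;
         concatMap-++; concatMap-cong; concatMap-map; map-concatMap)
open import Algebra.Structures using (IsMonoid)
open import Relation.Binary.Structures using (IsEquivalence)
open import Relation.Binary.PropositionalEquality as P using (_≡_)
open import Relation.Binary.Construct.Closure.Equivalence using (return)
open import Data.Vec.Functional as V using ()

module _ {C D : ℕ → Set}
         {supC : ∀ {n m} → C n → (Fin n → C m) → C m}
         {supD : ∀ {n m} → D n → (Fin n → D m) → D m}
         {R : ∀ n → C n → C n → Set} {S : ∀ n → D n → D n → Set} where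

  CloneCong-map : (f : ∀ {n} → C n → D n)
    → (∀ {n m} (x : C n) (ys : Fin n → C m)
       → CloneCong supD S m (f (supC x ys)) (supD (f x) (λ i → f (ys i))))
    → (∀ {n x y} → R n x y → CloneCong supD S n (f x) (f y))
    → ∀ {n x y} → CloneCong supC R n x y → CloneCong supD S n (f x) (f y)
  CloneCong-map f f-sup f-base (base r)  = f-base r
  CloneCong-map f f-sup f-base refl      = refl
  CloneCong-map f f-sup f-base (sym h)   = sym (CloneCong-map f f-sup f-base h)
  CloneCong-map f f-sup f-base (trans h k) =
    trans (CloneCong-map f f-sup f-base h) (CloneCong-map f f-sup f-base k)
  CloneCong-map f f-sup f-base (comp {x = x} {x'} {ys} {ys'} h hs) =
    trans (f-sup x ys)
      (trans (comp (CloneCong-map f f-sup f-base h)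
                   (λ i → CloneCong-map f f-sup f-base (hs i)))
             (sym (f-sup x' ys')))

CloneCong-reflexive : ∀ {C : ℕ → Set} {sup : ∀ {n m} → C n → (Fin n → C m) → C m}
  {R : ∀ n → C n → C n → Set} {n} {x y : C n} → x ≡ y → CloneCong sup R n x y
CloneCong-reflexive P.refl = refl

CloneCong-mono : ∀ {C : ℕ → Set} {sup : ∀ {n m} → C n → (Fin n → C m) → C m}
  {R S : ∀ n → C n → C n → Set} → (∀ {n x y} → R n x y → S n x y)
  → ∀ {n x y} → CloneCong sup R n x y → CloneCong sup S n x y
CloneCong-mono R⊆S = CloneCong-map (λ x → x) (λ _ _ → refl) (λ r → base (R⊆S r))

module PigmentedWords {M : Set} {_·_ : M → M → M} {e : M} (isMonoid : IsMonoid _≡_ _·_ e) where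
  open IsMonoid isMonoid using (identityˡ) renaming (assoc to ·-assoc)

  infixr 6 _⊙_
  _⊙_ : ∀ {m} → M → PW M m → PW M m
  α ⊙ w = act _·_ α w

  ⊙-⊙ : ∀ {m} α β (w : PW M m) → α ⊙ β ⊙ w ≡ (α · β) ⊙ w
  ⊙-⊙ α β w = P.trans (P.sym (map-∘ w))
                      (map-cong (λ { (j , γ) → P.cong (j ,_) (P.sym (·-assoc α β γ)) }) w)

  e⊙ : ∀ {m} (w : PW M m) → e ⊙ w ≡ w
  e⊙ w = P.trans (map-cong (λ { (j , γ) → P.cong (j ,_) (identityˡ γ) }) w) (map-id w)

  psup-++ : ∀ {n m} (w w' : PW M n) (ys : Fin n → PW M m)
          → psup _·_ (w ++ w') ys ≡ psup _·_ w ys ++ psup _·_ w' ys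
  psup-++ w w' ys = concatMap-++ _ w w'

  psup-⊙ : ∀ {n m} α (w : PW M n) (ys : Fin n → PW M m)
         → psup _·_ (α ⊙ w) ys ≡ α ⊙ psup _·_ w ys
  psup-⊙ α w ys =
    P.trans (concatMap-map _ _ w)
      (P.trans (concatMap-cong (λ { (i , β) → P.sym (⊙-⊙ α β (ys i)) }) w)
               (P.sym (map-concatMap _ _ w)))

  psup-congʳ : ∀ {n m} (w : PW M n) {ys ys' : Fin n → PW M m}
             → (∀ i → ys i ≡ ys' i) → psup _·_ w ys ≡ psup _·_ w ys'
  psup-congʳ w ys≡ys' = concatMap-cong (λ { (i , α) → P.cong (α ⊙_) (ys≡ys' i) }) w

  pproj-psup : ∀ {n m} (i : Fin n) (ys : Fin n → PW M m) → psup _·_ (pproj e i) ys ≡ ys i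
  pproj-psup i ys = P.trans (++-identityʳ _) (e⊙ (ys i))

module Combs {M : Set} (_·_ : M → M → M) (e : M) where

  infix 4 _≃_
  _≃_ : ∀ {n} → Term M n → Term M n → Set
  _≃_ {n} = CloneCong tsub (RMgen _·_ e) n

  RMgen-instance : ∀ {n m a b} → RMgen _·_ e n a b → (σ : Fin n → Term M m)
                 → tsub a σ ≃ tsub b σ
  RMgen-instance g σ = comp (base g) (λ _ → refl)

  star-cong : ∀ {m} {a a' b b' : Term M m} → a ≃ a' → b ≃ b' → star a b ≃ star a' b'
  star-cong {a = a} {a'} {b} {b'} a≃a' b≃b' =
    comp {x = star (var zero) (var (suc zero))}
         {ys = a V.∷ b V.∷ V.[]} {ys' = a' V.∷ b' V.∷ V.[]} refl
         λ { zero → a≃a' ; (suc zero) → b≃b' }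

  p-cong : ∀ {m} α {a a' : Term M m} → a ≃ a' → p α a ≃ p α a'
  p-cong α {a} {a'} a≃a' =
    comp {x = p α (var zero)} {ys = λ (_ : Fin 1) → a} {ys' = λ _ → a'} refl λ _ → a≃a'

  toTerm : ∀ {n} → PW M n → Term M n
  toTerm [] = u
  toTerm ((i , α) ∷ w) = star (p α (var i)) (toTerm w)

  toTerm-++ : ∀ {n} (w w' : PW M n) → toTerm (w ++ w') ≃ star (toTerm w) (toTerm w')
  toTerm-++ [] w' = sym (RMgen-instance unitˡ (λ _ → toTerm w'))
  toTerm-++ ((i , α) ∷ w) w' =
    trans (star-cong refl (toTerm-++ w w'))
          (sym (RMgen-instance assoc (p α (var i) V.∷ toTerm w V.∷ toTerm w' V.∷ V.[])))

  toTerm-⊙ : ∀ {n} α (w : PW M n) → toTerm (act _·_ α w) ≃ p α (toTerm w)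
  toTerm-⊙ α [] = sym (RMgen-instance (p-u α) V.[])
  toTerm-⊙ α ((i , β) ∷ w) =
    trans (star-cong (sym (RMgen-instance (p-p α β) (λ _ → var i))) (toTerm-⊙ α w))
          (sym (RMgen-instance (p-star α) (p β (var i) V.∷ toTerm w V.∷ V.[])))

module Frontier {M : Set} {_·_ : M → M → M} {e : M} (isMonoid : IsMonoid _≡_ _·_ e) where
  open IsMonoid isMonoid using (identityʳ)
  open PigmentedWords isMonoid
  open Combs _·_ e

  fr-p : ∀ {n} α (t : Term M n) → fr _·_ e (p α t) ≡ α ⊙ fr _·_ e t
  fr-p α t = ++-identityʳ _

  fr-star : ∀ {n} (a b : Term M n) → fr _·_ e (star a b) ≡ fr _·_ e a ++ fr _·_ e b
  fr-star a b = P.cong₂ _++_ (e⊙ (fr _·_ e a)) (P.trans (++-identityʳ _) (e⊙ (fr _·_ e b)))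

  fr-tsub : ∀ {n m} (t : Term M n) (σ : Fin n → Term M m)
          → fr _·_ e (tsub t σ) ≡ psup _·_ (fr _·_ e t) (λ i → fr _·_ e (σ i))
  fr-tsub (var i) σ = P.sym (pproj-psup i (λ j → fr _·_ e (σ j)))
  fr-tsub u σ = P.refl
  fr-tsub (p α t) σ = begin
    fr _·_ e (p α (tsub t σ))              ≡⟨ fr-p α (tsub t σ) ⟩
    α ⊙ fr _·_ e (tsub t σ)                ≡⟨ P.cong (α ⊙_) (fr-tsub t σ) ⟩
    α ⊙ psup _·_ (fr _·_ e t) frσ          ≡⟨ psup-⊙ α (fr _·_ e t) frσ ⟨
    psup _·_ (α ⊙ fr _·_ e t) frσ          ≡⟨ P.cong (λ w → psup _·_ w frσ) (fr-p α t) ⟨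
    psup _·_ (fr _·_ e (p α t)) frσ        ∎
    where open P.≡-Reasoning
          frσ = λ i → fr _·_ e (σ i)
  fr-tsub (star a b) σ = begin
    fr _·_ e (star (tsub a σ) (tsub b σ))                    ≡⟨ fr-star (tsub a σ) (tsub b σ) ⟩
    fr _·_ e (tsub a σ) ++ fr _·_ e (tsub b σ)               ≡⟨ P.cong₂ _++_ (fr-tsub a σ) (fr-tsub b σ) ⟩
    psup _·_ (fr _·_ e a) frσ ++ psup _·_ (fr _·_ e b) frσ   ≡⟨ psup-++ (fr _·_ e a) (fr _·_ e b) frσ ⟨
    psup _·_ (fr _·_ e a ++ fr _·_ e b) frσ                  ≡⟨ P.cong (λ w → psup _·_ w frσ) (fr-star a b) ⟨
    psup _·_ (fr _·_ e (star a b)) frσ                       ∎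
    where open P.≡-Reasoning
          frσ = λ i → fr _·_ e (σ i)

  toTerm-fr : ∀ {n} (t : Term M n) → toTerm (fr _·_ e t) ≃ t
  toTerm-fr (var i) =
    trans (sym (RMgen-instance unitʳ (λ _ → p e (var i)))) (RMgen-instance p-e (λ _ → var i))
  toTerm-fr u = refl
  toTerm-fr (p α t) =
    trans (CloneCong-reflexive (P.cong toTerm (fr-p α t)))
      (trans (toTerm-⊙ α (fr _·_ e t)) (p-cong α (toTerm-fr t)))
  toTerm-fr (star a b) =
    trans (CloneCong-reflexive (P.cong toTerm (fr-star a b)))
      (trans (toTerm-++ (fr _·_ e a) (fr _·_ e b)) (star-cong (toTerm-fr a) (toTerm-fr b)))

  fr-toTerm : ∀ {n} (w : PW M n) → fr _·_ e (toTerm w) ≡ w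
  fr-toTerm [] = P.refl
  fr-toTerm ((i , α) ∷ w) =
    P.trans (fr-star (p α (var i)) (toTerm w))
            (P.cong₂ (λ β w' → (i , β) ∷ w') (identityʳ α) (fr-toTerm w))

  toTerm-psup : ∀ {n m} (w : PW M n) (ys : Fin n → PW M m)
              → toTerm (psup _·_ w ys) ≃ tsub (toTerm w) (λ i → toTerm (ys i))
  toTerm-psup w ys = trans (CloneCong-reflexive (P.cong toTerm frontier)) (toTerm-fr _)
    where
      frontier : psup _·_ w ys ≡ fr _·_ e (tsub (toTerm w) (λ i → toTerm (ys i)))
      frontier = P.sym (P.trans (fr-tsub (toTerm w) _)
                         (P.trans (P.cong (λ v → psup _·_ v _) (fr-toTerm w))
                                  (psup-congʳ w (λ i → fr-toTerm (ys i)))))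

module Presentation {M : Set} {_·_ : M → M → M} {e : M} (isMonoid : IsMonoid _≡_ _·_ e)
                    (R' : ∀ n → Term M n → Term M n → Set)
                    (RM⊆R' : ∀ n t t' → RM _·_ e n t t' → R' n t t') where
  open Combs _·_ e
  open Frontier isMonoid

  infix 4 _≈ᵀ_ _≈ᴾ_
  _≈ᵀ_ : ∀ {n} → Term M n → Term M n → Set
  _≈ᵀ_ {n} = CloneCong tsub R' n

  _≈ᴾ_ : ∀ {n} → PW M n → PW M n → Set
  _≈ᴾ_ {n} = CloneCong (psup _·_) (FrPairs _·_ e R') n

  ≃⇒≈ᵀ : ∀ {n} {t t' : Term M n} → t ≃ t' → t ≈ᵀ t'
  ≃⇒≈ᵀ = CloneCong-mono (λ g → RM⊆R' _ _ _ (return g))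

  fr-resp : ∀ {n} {t t' : Term M n} → t ≈ᵀ t' → fr _·_ e t ≈ᴾ fr _·_ e t'
  fr-resp = CloneCong-map (fr _·_ e) (λ t σ → CloneCong-reflexive (fr-tsub t σ))
                          (λ r → base (_ , _ , r , P.refl , P.refl))

  toTerm-resp : ∀ {n} {w w' : PW M n} → w ≈ᴾ w' → toTerm w ≈ᵀ toTerm w'
  toTerm-resp = CloneCong-map toTerm (λ w ys → ≃⇒≈ᵀ (toTerm-psup w ys))
    λ { (t , t' , r , P.refl , P.refl) →
          trans (≃⇒≈ᵀ (toTerm-fr t)) (trans (base r) (sym (≃⇒≈ᵀ (toTerm-fr t')))) }

  fr-injective : ∀ {n} {t t' : Term M n} → fr _·_ e t ≈ᴾ fr _·_ e t' → t ≈ᵀ t'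
  fr-injective {t = t} {t'} h =
    trans (sym (≃⇒≈ᵀ (toTerm-fr t))) (trans (toTerm-resp h) (≃⇒≈ᵀ (toTerm-fr t')))

-- R' need not be an equivalence: the generated congruence closes it anyway.
proposition3p3p7 :
    (M : Set) (_·_ : M → M → M) (e : M) → IsMonoid _≡_ _·_ e →
    (R' : ∀ n → Term M n → Term M n → Set) →
    (∀ n → IsEquivalence (R' n)) →
    (∀ n t t' → RM _·_ e n t t' → R' n t t') →
    CloneIso {Term M} {PW M}
      tsub tproj (λ {n} → CloneCong tsub R' n)
      (psup _·_) (pproj e) (λ {n} → CloneCong (psup _·_) (FrPairs _·_ e R') n)
proposition3p3p7 M _·_ e isMonoid R' _ RM⊆R' = record
  { φ      = fr _·_ e
  ; φ-resp = fr-resp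
  ; φ-inj  = fr-injective
  ; φ-surj = λ w → toTerm w , CloneCong-reflexive (fr-toTerm w)
  ; φ-sup  = λ t σ → CloneCong-reflexive (fr-tsub t σ)
  ; φ-proj = λ i → refl
  }
  where
    open Combs _·_ e
    open Frontier isMonoid
    open Presentation isMonoid R' RM⊆R'
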